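{- Let $T$ be a finite rooted tree in which every inner node has at least two children, with leaf set $L$ and node set $V$. Let $A,B\subseteq L$ be disjoint and let $S,S'\subseteq V\setminus L$. If $(A,B)$ identifies both $S$ and $S'$, then $S=S'$.
   Context: A pair $(\pi,\sigma)$ of injective maps from $S$ to $L$ identifies $S$ if for each $s\in S$, $s$ is the least common ancestor of $\pi(s)$ and $\sigma(s)$ (every node is its own ancestor). A node $x$ is $s$-requested in $(\pi,\sigma)$ if $x$ lies on the path from $\pi(s)$ to $\sigma(s)$; the pair has unique request if every node is $s$-requested for at most one $s\in S$. A pair $(A,B)$ of disjoint subsets of $L$ of the same cardinality (a bi-colouring) identifies $S$ if there exists a pair $(\pi,\sigma)$ of injective maps from $S$ to $L$ identifying $S$ with unique request such that $\pi(S)=A$ and $\sigma(S)=B$. -}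

module Defs where

open import Data.Nat using (ℕ; _≤_)
open import Data.List using (List; []; length; lookup)
open import Data.List.Relation.Unary.All using (All)
open import Data.Fin using (Fin)
open import Data.Product using (Σ; _×_; ∃; ∃-syntax; _,_)
open import Data.Sum using (_⊎_)
open import Data.Empty using (⊥)
open import Relation.Nullary using (¬_)
open import Relation.Binary.PropositionalEquality using (_≡_)
open import Function.Bundles using (_⇔_)

data Tree : Set where
  node : List Tree → Tree

data Full : Tree → Set where
  full : ∀ {ts} → (length ts ≡ 0 ⊎ 2 ≤ length ts) → All Full ts → Full (node ts)

-- Nodes of a tree, given by their address from the root.
data Pos : Tree → Set where
  here : ∀ {t} → Pos t
  down : ∀ {ts} (i : Fin (length ts)) → Pos (lookup ts i) → Pos (node ts)

subtree : ∀ {t} → Pos t → Tree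
subtree {t} here = t
subtree (down i p) = subtree p

IsLeaf : ∀ {t} → Pos t → Set
IsLeaf p = subtree p ≡ node []

-- x ≼ y : x is an ancestor of y (every node is its own ancestor).
data _≼_ : ∀ {t} → Pos t → Pos t → Set where
  ≼-here : ∀ {t} {y : Pos t} → here ≼ y
  ≼-down : ∀ {ts} {i : Fin (length ts)} {x y : Pos (lookup ts i)} →
           x ≼ y → down {ts} i x ≼ down i y

IsLCA : ∀ {t} → Pos t → Pos t → Pos t → Set
IsLCA s x y = s ≼ x × s ≼ y × (∀ z → z ≼ x → z ≼ y → z ≼ s)

-- z lies on the (unique) path in the tree between x and y:
-- z is an ancestor of x or of y, and z is below every common ancestor of x and y
-- (i.e. below their least common ancestor).
OnPath : ∀ {t} → Pos t → Pos t → Pos t → Set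
OnPath z x y = (z ≼ x ⊎ z ≼ y) × (∀ c → c ≼ x → c ≼ y → c ≼ z)

NodeSet : Tree → Set₁
NodeSet t = Pos t → Set

-- π is an injective map from S to L (π given as a total function, constrained on S).
InjToLeaves : ∀ {t} → NodeSet t → (Pos t → Pos t) → Set
InjToLeaves S π =
  (∀ s → S s → IsLeaf (π s)) ×
  (∀ s s' → S s → S s' → π s ≡ π s' → s ≡ s')

ImageIs : ∀ {t} → NodeSet t → (Pos t → Pos t) → NodeSet t → Set
ImageIs S π A = ∀ x → (A x ⇔ (∃[ s ] (S s × π s ≡ x)))

PairIdentifies : ∀ {t} → NodeSet t → (Pos t → Pos t) → (Pos t → Pos t) → Set
PairIdentifies S π σ = ∀ s → S s → IsLCA s (π s) (σ s)

Requested : ∀ {t} → (Pos t → Pos t) → (Pos t → Pos t) → Pos t → Pos t → Set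
Requested π σ s x = OnPath x (π s) (σ s)

UniqueRequest : ∀ {t} → NodeSet t → (Pos t → Pos t) → (Pos t → Pos t) → Set
UniqueRequest S π σ =
  ∀ x s s' → S s → S s' → Requested π σ s x → Requested π σ s' x → s ≡ s'

Identifies : ∀ {t} → NodeSet t → NodeSet t → NodeSet t → Set
Identifies {t} A B S =
  Σ (Pos t → Pos t) λ π → Σ (Pos t → Pos t) λ σ →
    InjToLeaves S π × InjToLeaves S σ ×
    PairIdentifies S π σ × UniqueRequest S π σ ×
    ImageIs S π A × ImageIs S σ B

-- Let s ∈ S and s' ∈ S' share the π-end ℓ. Both are ancestors of ℓ, hence comparable; say
-- s ≼ s'. Let t ∈ S share the σ-end ℓ' of s'. The pair (s', t) is the same situation with the
-- roles of S, S' and of π, σ exchanged, so if s' ≺ t then t ≼ s' by induction on how deep the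
-- lower node lies. Hence t ≼ s' anyway, and s' lies on the paths of both s and t, so unique
-- request gives s = t. Now s' is a common ancestor of both ends ℓ, ℓ' of s, whence s' ≼ s,
-- so s = s' and S ⊆ S'.
module Submission where

open import Defs
open import Data.Product using (_×_)
open import Data.Empty using (⊥)
open import Relation.Nullary using (¬_)
open import Function.Bundles using (_⇔_)

open import Data.Nat using (ℕ; suc; _≤_; _<_; _⊔_; s≤s)
open import Data.Nat.Properties using (≤-trans; <-≤-trans; m≤m⊔n; m≤n⊔m; ≤-refl; <⇒≤)
open import Data.Nat.Induction using (<-wellFounded)
open import Data.List using (List; []; _∷_; length; lookup)
open import Data.Fin using (Fin; zero; suc)
open import Data.Fin.Properties using () renaming (_≟_ to _≟ᶠ_)
open import Data.Product using (_,_; proj₁; proj₂; ∃-syntax)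
open import Data.Sum using (_⊎_; inj₁; inj₂)
open import Data.Empty using (⊥-elim)
open import Function.Base using (flip; _∘_)
open import Function.Bundles using (Equivalence; mk⇔)
open import Induction.WellFounded using (WellFounded; Acc; acc; module Subrelation)
open import Relation.Binary.Construct.On using () renaming (wellFounded to on-wellFounded)
open import Relation.Nullary using (Dec; yes; no)
open import Relation.Binary.PropositionalEquality using (_≡_; refl; sym; cong; subst)

≼-trans : ∀ {t} {x y z : Pos t} → x ≼ y → y ≼ z → x ≼ z
≼-trans ≼-here _ = ≼-here
≼-trans (≼-down p) (≼-down q) = ≼-down (≼-trans p q)

≼-antisym : ∀ {t} {x y : Pos t} → x ≼ y → y ≼ x → x ≡ y
≼-antisym ≼-here ≼-here = refl
≼-antisym (≼-down p) (≼-down q) = cong (down _) (≼-antisym p q)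

common-descendant⇒comparable : ∀ {t} {x y z : Pos t} → x ≼ z → y ≼ z → x ≼ y ⊎ y ≼ x
common-descendant⇒comparable ≼-here _ = inj₁ ≼-here
common-descendant⇒comparable (≼-down _) ≼-here = inj₂ ≼-here
common-descendant⇒comparable (≼-down p) (≼-down q) with common-descendant⇒comparable p q
... | inj₁ r = inj₁ (≼-down r)
... | inj₂ r = inj₂ (≼-down r)

_≼?_ : ∀ {t} (x y : Pos t) → Dec (x ≼ y)
here ≼? y = yes ≼-here
down i x ≼? here = no λ ()
down i x ≼? down j y with i ≟ᶠ j
... | no i≢j = no λ { (≼-down _) → i≢j refl }
... | yes refl with x ≼? y
...   | yes x≼y = yes (≼-down x≼y)
...   | no x⋠y = no λ { (≼-down x≼y) → x⋠y x≼y }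

_≺_ : ∀ {t} → Pos t → Pos t → Set
x ≺ y = x ≼ y × ¬ (y ≼ x)

_≻_ : ∀ {t} → Pos t → Pos t → Set
_≻_ = flip _≺_

common-descendant⇒≼⊎≻ : ∀ {t} {x y z : Pos t} → x ≼ z → y ≼ z → x ≼ y ⊎ x ≻ y
common-descendant⇒≼⊎≻ {x = x} {y = y} x≼z y≼z with x ≼? y
... | yes x≼y = inj₁ x≼y
... | no x⋠y with common-descendant⇒comparable x≼z y≼z
...   | inj₁ x≼y = ⊥-elim (x⋠y x≼y)
...   | inj₂ y≼x = inj₂ (y≼x , x⋠y)

IsLCA-sym : ∀ {t} {s x y : Pos t} → IsLCA s x y → IsLCA s y x
IsLCA-sym (s≼x , s≼y , greatest) = s≼y , s≼x , λ z z≼y z≼x → greatest z z≼x z≼y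

OnPath-sym : ∀ {t} {z x y : Pos t} → OnPath z x y → OnPath z y x
OnPath-sym (inj₁ z≼x , below) = inj₂ z≼x , λ c c≼y c≼x → below c c≼x c≼y
OnPath-sym (inj₂ z≼y , below) = inj₁ z≼y , λ c c≼y c≼x → below c c≼x c≼y

below-lca⇒OnPath : ∀ {t} {s z x y : Pos t} → IsLCA s x y → s ≼ z → z ≼ x ⊎ z ≼ y → OnPath z x y
below-lca⇒OnPath (_ , _ , greatest) s≼z z≼x⊎z≼y =
  z≼x⊎z≼y , λ c c≼x c≼y → ≼-trans (greatest c c≼x c≼y) s≼z

height : Tree → ℕ
max-height : List Tree → ℕ
height (node ts) = suc (max-height ts)
max-height [] = 0
max-height (t ∷ ts) = height t ⊔ max-height ts

lookup-height< : (ts : List Tree) (i : Fin (length ts)) → height (lookup ts i) < height (node ts)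
lookup-height< (t ∷ ts) zero = s≤s (m≤m⊔n (height t) (max-height ts))
lookup-height< (t ∷ ts) (suc i) =
  <-≤-trans (lookup-height< ts i) (s≤s (m≤n⊔m (height t) (max-height ts)))

height-subtree≤ : ∀ {t} (p : Pos t) → height (subtree p) ≤ height t
height-subtree≤ here = ≤-refl
height-subtree≤ {node ts} (down i p) = ≤-trans (height-subtree≤ p) (<⇒≤ (lookup-height< ts i))

≺⇒height-subtree> : ∀ {t} {x y : Pos t} → x ≺ y → height (subtree y) < height (subtree x)
≺⇒height-subtree> {node ts} {y = here} (_ , y⋠x) = ⊥-elim (y⋠x ≼-here)
≺⇒height-subtree> {node ts} {y = down i q} (≼-here , _) =
  <-≤-trans (s≤s (height-subtree≤ q)) (lookup-height< ts i)
≺⇒height-subtree> (≼-down x≼y , y⋠x) = ≺⇒height-subtree> (x≼y , λ y≼x → y⋠x (≼-down y≼x))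

≻-wellFounded : ∀ {t} → WellFounded (_≻_ {t})
≻-wellFounded =
  Subrelation.wellFounded ≺⇒height-subtree> (on-wellFounded (height ∘ subtree) <-wellFounded)

preimage-of-common-image : ∀ {t} {S S' C : NodeSet t} {f g : Pos t → Pos t} →
  ImageIs S f C → ImageIs S' g C → ∀ {s'} → S' s' → ∃[ s ] (S s × f s ≡ g s')
preimage-of-common-image f-image g-image {s'} S's' =
  Equivalence.to (f-image _) (Equivalence.from (g-image _) (s' , S's' , refl))

module _ {T : Tree} where

  record Identification (A B S : NodeSet T) : Set where
    field
      π σ : Pos T → Pos T
      lca : PairIdentifies S π σ
      unique-request : UniqueRequest S π σ
      π-image : ImageIs S π A
      σ-image : ImageIs S σ B

  open Identification

  Identifies⇒Identification : ∀ {A B S} → Identifies A B S → Identification A B S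
  Identifies⇒Identification (π , σ , _ , _ , lca , unique-request , π-image , σ-image) =
    record { π = π ; σ = σ ; lca = lca ; unique-request = unique-request
           ; π-image = π-image ; σ-image = σ-image }

  swap : ∀ {A B S} → Identification A B S → Identification B A S
  swap X = record
    { π = σ X ; σ = π X
    ; lca = λ s Ss → IsLCA-sym (lca X s Ss)
    ; unique-request = λ z s s' Ss Ss' z-on-s z-on-s' →
        unique-request X z s s' Ss Ss' (OnPath-sym z-on-s) (OnPath-sym z-on-s')
    ; π-image = σ-image X ; σ-image = π-image X }

  module _ {A B S} (X : Identification A B S) {s} (Ss : S s) where

    ancestor-π : s ≼ π X s
    ancestor-π = proj₁ (lca X s Ss)

    ancestor-σ : s ≼ σ X s
    ancestor-σ = proj₁ (proj₂ (lca X s Ss))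

    greatest-common-ancestor : ∀ z → z ≼ π X s → z ≼ σ X s → z ≼ s
    greatest-common-ancestor = proj₂ (proj₂ (lca X s Ss))

  shared-π-end-≼⇒≽ : ∀ {A B S S' s s'} (X : Identification A B S) (Y : Identification A B S') →
    Acc _≻_ s' → S s → S' s' → π X s ≡ π Y s' → s ≼ s' → s' ≼ s
  shared-π-end-≼⇒≽ {s = s} {s'} X Y (acc rec) Ss S's' π-shared s≼s'
    with t , St , σ-shared ← preimage-of-common-image (σ-image X) (σ-image Y) S's' =
    greatest-common-ancestor X Ss s' s'≼πXs (subst (λ u → s' ≼ σ X u) (sym s≡t) s'≼σXt)
    where
    s'≼πXs : s' ≼ π X s
    s'≼πXs = subst (s' ≼_) (sym π-shared) (ancestor-π Y S's')
    s'≼σXt : s' ≼ σ X t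
    s'≼σXt = subst (s' ≼_) (sym σ-shared) (ancestor-σ Y S's')
    t≼s' : t ≼ s'
    t≼s' with common-descendant⇒≼⊎≻ (ancestor-σ X St) s'≼σXt
    ... | inj₁ t≼s' = t≼s'
    ... | inj₂ t≻s'@(s'≼t , _) =
      shared-π-end-≼⇒≽ (swap Y) (swap X) (rec t≻s') S's' St (sym σ-shared) s'≼t
    s≡t : s ≡ t
    s≡t = unique-request X s' s t Ss St
      (below-lca⇒OnPath (lca X s Ss) s≼s' (inj₁ s'≼πXs))
      (below-lca⇒OnPath (lca X t St) t≼s' (inj₂ s'≼σXt))

  shared-π-end⇒≡ : ∀ {A B S S' s s'} (X : Identification A B S) (Y : Identification A B S') →
    S s → S' s' → π X s ≡ π Y s' → s ≡ s'
  shared-π-end⇒≡ {s' = s'} X Y Ss S's' π-shared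
    with common-descendant⇒comparable (ancestor-π X Ss)
                                      (subst (s' ≼_) (sym π-shared) (ancestor-π Y S's'))
  ... | inj₁ s≼s' = ≼-antisym s≼s' (shared-π-end-≼⇒≽ X Y (≻-wellFounded _) Ss S's' π-shared s≼s')
  ... | inj₂ s'≼s = ≼-antisym (shared-π-end-≼⇒≽ Y X (≻-wellFounded _) S's' Ss (sym π-shared) s'≼s) s'≼s

  identified-⊆ : ∀ {A B S S'} → Identification A B S → Identification A B S' → ∀ {x} → S x → S' x
  identified-⊆ {S' = S'} X Y Sx
    with s' , S's' , π-shared ← preimage-of-common-image (π-image Y) (π-image X) Sx =
    subst S' (sym (shared-π-end⇒≡ X Y Sx S's' (sym π-shared))) S's'

lemma3p6 : (T : Tree) → Full T →
    (A B S S' : NodeSet T) →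
    (∀ x → A x → IsLeaf x) → (∀ x → B x → IsLeaf x) →
    (∀ x → A x → B x → ⊥) →
    (∀ x → S x → ¬ IsLeaf x) → (∀ x → S' x → ¬ IsLeaf x) →
    Identifies A B S → Identifies A B S' →
    ∀ x → (S x ⇔ S' x)
lemma3p6 T _ A B S S' _ _ _ _ _ S-identified S'-identified x =
  mk⇔ (identified-⊆ X Y) (identified-⊆ Y X)
  where
  X : Identification A B S
  X = Identifies⇒Identification S-identified
  Y : Identification A B S'
  Y = Identifies⇒Identification S'-identified
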